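{- Let $(T,f)$ be a partial branch-decomposition of a connectivity system $K=(E,\lambda)$. Let $Y$ be the set displayed by a leaf $r$ of $T$, let $X\subseteq E\setminus Y$, and let $(T,f')$ be the partial branch-decomposition defined by $f'(x)=f(x)$ for all $x\in X$ and $f'(x)=r$ for all $x\in E\setminus X$. If $\lambda(X)=\kappa_K(X,Y)$, then the width of each edge in $(T,f')$ is at most the width of the same edge in $(T,f)$.
   Context: A connectivity system is a pair $(E,\lambda)$, $E$ finite, $\lambda$ a non-negative integer-valued function on subsets of $E$ with $\lambda(X)=\lambda(E\setminus X)$ and $\lambda(X\cap Y)+\lambda(X\cup Y)\le\lambda(X)+\lambda(Y)$. For disjoint $X,Y\subseteq E$, $\kappa_K(X,Y)$ is the minimum of $\lambda(Z)$ over all $Z$ with $X\subseteq Z\subseteq E\setminus Y$. A cubic tree is a tree whose vertices have degree 1 or 3 (degree-1 vertices are leaves). A partial branch-decomposition of $K$ is a pair $(T,f)$ with $T$ a cubic tree and $f$ a map from $E$ to the leaves of $T$; a leaf $v$ displays $f^{ -1}(v)$; for an edge $e$ of $T$, the width of $e$ is $\lambda(A_e)$ where $A_e$ is the set of elements mapped by $f$ into one component of $T-e$ (by symmetry of $\lambda$ the choice of component does not matter). -}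

module Defs where

open import Data.Nat using (ℕ; _+_; _≤_)
open import Data.Fin using (Fin; _≟_)
open import Data.Fin.Subset using (Subset; _∈_; _∉_; _⊆_; _∩_; _∪_; ∁)
open import Data.Fin.Subset.Properties using (_∈?_)
open import Data.Product using (Σ; _×_; _,_; proj₁; proj₂)
open import Data.Sum using (_⊎_)
open import Data.List using (List; []; _∷_)
open import Data.Vec.Functional using (Vector)
open import Relation.Nullary using (¬_; does)
open import Relation.Binary.PropositionalEquality using (_≡_; _≢_)
open import Data.Bool using (if_then_else_)
open import Function.Bundles using (_⇔_)

-- Connectivity systems.  The ground set E is Fin n; subsets are
-- Data.Fin.Subset (Vec Bool n), so E ∖ X is ∁ X.

record ConnectivitySystem (n : ℕ) : Set where
  field
    conn      : Subset n → ℕ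
    symmetric : ∀ X → conn X ≡ conn (∁ X)
    submod    : ∀ X Y → conn (X ∩ Y) + conn (X ∪ Y) ≤ conn X + conn Y

open ConnectivitySystem public

IsKappa : ∀ {n} → ConnectivitySystem n → Subset n → Subset n → ℕ → Set
IsKappa K X Y k =
  (Σ (Subset _) λ Z → X ⊆ Z × Z ⊆ ∁ Y × conn K Z ≡ k)
  × (∀ Z → X ⊆ Z → Z ⊆ ∁ Y → k ≤ conn K Z)

record Graph : Set where
  field
    nV   : ℕ
    nE   : ℕ
    ends : Fin nE → Fin nV × Fin nV

open Graph public

data Reach (G : Graph) (allowed : Fin (nE G) → Set) :
           Fin (nV G) → Fin (nV G) → Set where
  here  : ∀ {u} → Reach G allowed u u
  step  : ∀ {u v w} (i : Fin (nE G)) → allowed i →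
          (proj₁ (ends G i) ≡ u × proj₂ (ends G i) ≡ v
           ⊎ proj₂ (ends G i) ≡ u × proj₁ (ends G i) ≡ v) →
          Reach G allowed v w → Reach G allowed u w

Reachable : (G : Graph) → Fin (nV G) → Fin (nV G) → Set
Reachable G = Reach G (λ _ → Data.Unit.⊤)
  where import Data.Unit

ReachableWithout : (G : Graph) → Fin (nE G) → Fin (nV G) → Fin (nV G) → Set
ReachableWithout G e = Reach G (λ i → i ≢ e)

-- A tree: connected and acyclic; acyclic is expressed as "no edge lies
-- on a cycle", i.e. for every edge its ends are not joined in G - e.
IsTree : Graph → Set
IsTree G = (∀ u v → Reachable G u v)
         × (∀ e → ¬ ReachableWithout G e (proj₁ (ends G e)) (proj₂ (ends G e)))

-- degree of v (a loop would count twice)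
degree : (G : Graph) → Fin (nV G) → ℕ
degree G v = sumE (nE G) (λ i → ind (proj₁ (ends G i)) + ind (proj₂ (ends G i)))
  where
    ind : Fin (nV G) → ℕ
    ind w = if does (w ≟ v) then 1 else 0
    sumE : (k : ℕ) → (Fin k → ℕ) → ℕ
    sumE ℕ.zero    g = 0
    sumE (ℕ.suc k) g = g Fin.zero + sumE k (λ i → g (Fin.suc i))

IsLeaf : (G : Graph) → Fin (nV G) → Set
IsLeaf G v = degree G v ≡ 1

IsCubicTree : Graph → Set
IsCubicTree G = IsTree G × (∀ v → degree G v ≡ 1 ⊎ degree G v ≡ 3)

IsPartialBranchDecomposition : (n : ℕ) (T : Graph) → (Fin n → Fin (nV T)) → Set
IsPartialBranchDecomposition n T f = IsCubicTree T × (∀ x → IsLeaf T (f x))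

IsSideOf : ∀ {n} (T : Graph) (f : Fin n → Fin (nV T)) (e : Fin (nE T)) → Subset n → Set
IsSideOf T f e A = ∀ x → (x ∈ A) ⇔ ReachableWithout T e (proj₁ (ends T e)) (f x)

IsWidth : ∀ {n} (K : ConnectivitySystem n) (T : Graph) (f : Fin n → Fin (nV T))
          (e : Fin (nE T)) → ℕ → Set
IsWidth K T f e w = Σ _ λ A → IsSideOf T f e A × conn K A ≡ w

Displays : ∀ {n} (T : Graph) (f : Fin n → Fin (nV T)) → Fin (nV T) → Subset n → Set
Displays T f r Y = ∀ x → (x ∈ Y) ⇔ (f x ≡ r)

redirect : ∀ {n} {V : ℕ} (f : Fin n → Fin V) (X : Subset n) (r : Fin V) → Fin n → Fin V
redirect f X r x = if does (x ∈? X) then f x else r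

-- Let S be the component of T - e containing the first end of e, so that
-- the sides of e in (T,f) and (T,f′) are the preimages A and A′ of S.
-- Elements of X keep their leaf and all others move to r, hence
-- A′ = X ∩ A when r ∉ S and A′ = E ∖ (X ∩ (E ∖ A)) when r ∈ S.  So up to
-- complement A′ is X ∩ Z for a side Z of e in (T,f) that avoids Y, and
-- uncrossing gives λ(X ∩ Z) ≤ λ(Z): submodularity bounds
-- λ(X ∩ Z) + λ(X ∪ Z) by λ(X) + λ(Z), while X ∪ Z still separates X
-- from Y, so λ(X ∪ Z) ≥ κ(X,Y) = λ(X).
module Submission where

open import Defs
open import Data.Nat using (ℕ; _≤_; _+_)
open import Data.Nat.Properties using (+-monoˡ-≤; +-cancelʳ-≤; +-comm; module ≤-Reasoning)
open import Data.Fin using (Fin)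
open import Data.Fin.Properties using (any?)
open import Data.Fin.Subset using (Subset; _⊆_; ∁; _∈_; _∉_; _∩_; _∪_)
open import Data.Fin.Subset.Properties
  using (_∈?_; ⊆-antisym; p⊆p∪q; x∈p∪q⁻; x∈p∩q⁺; x∈p∩q⁻; x∈∁p⇒x∉p; x∉p⇒x∈∁p; p⊆q⇒∁p⊇∁q)
open import Data.Product using (_,_; proj₁)
open import Data.Sum using (_⊎_; inj₁; inj₂)
open import Relation.Nullary using (yes; no)
open import Relation.Nullary.Decidable using (_×-dec_; ¬?)
open import Relation.Nullary.Negation using (contradiction)
open import Relation.Binary.PropositionalEquality using (_≡_; refl; sym; cong; subst)
open import Function.Bundles using (_⇔_; module Equivalence)

open Equivalence using (to; from)

kappa-minimal-∩-≤ : ∀ {n} (K : ConnectivitySystem n) {X Y Z : Subset n} →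
                    IsKappa K X Y (conn K X) → Z ⊆ ∁ Y →
                    conn K (X ∩ Z) ≤ conn K Z
kappa-minimal-∩-≤ K {X} {Y} {Z} ((_ , X⊆W , W⊆∁Y , _) , minimal) Z⊆∁Y =
  +-cancelʳ-≤ (conn K (X ∪ Z)) _ _ (begin
    conn K (X ∩ Z) + conn K (X ∪ Z) ≤⟨ submod K X Z ⟩
    conn K X + conn K Z             ≤⟨ +-monoˡ-≤ (conn K Z) X≤X∪Z ⟩
    conn K (X ∪ Z) + conn K Z       ≡⟨ +-comm (conn K (X ∪ Z)) (conn K Z) ⟩
    conn K Z + conn K (X ∪ Z)       ∎)
  where
    open ≤-Reasoning
    X∪Z⊆∁Y : X ∪ Z ⊆ ∁ Y
    X∪Z⊆∁Y x∈X∪Z with x∈p∪q⁻ X Z x∈X∪Z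
    ... | inj₁ x∈X = W⊆∁Y (X⊆W x∈X)
    ... | inj₂ x∈Z = Z⊆∁Y x∈Z
    X≤X∪Z : conn K X ≤ conn K (X ∪ Z)
    X≤X∪Z = minimal (X ∪ Z) (p⊆p∪q Z) X∪Z⊆∁Y

IsPreimage : ∀ {n V} → (Fin n → Fin V) → (Fin V → Set) → Subset n → Set
IsPreimage f S A = ∀ x → x ∈ A ⇔ S (f x)

module _ {n V} (f : Fin n → Fin V) (X : Subset n) (r : Fin V) where

  redirect-∈ : ∀ {x} → x ∈ X → redirect f X r x ≡ f x
  redirect-∈ {x} x∈X with x ∈? X
  ... | yes _   = refl
  ... | no x∉X = contradiction x∈X x∉X

  redirect-∉ : ∀ {x} → x ∉ X → redirect f X r x ≡ r
  redirect-∉ {x} x∉X with x ∈? X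
  ... | yes x∈X = contradiction x∈X x∉X
  ... | no _    = refl

module RedirectedPreimage {n V} (f : Fin n → Fin V) (X : Subset n) (r : Fin V)
                        (S : Fin V → Set) {A A′ : Subset n}
                        (A-pre : IsPreimage f S A) (A′-pre : IsPreimage (redirect f X r) S A′) where

  ∈X∩A⇒∈A′ : ∀ {x} → x ∈ X → x ∈ A → x ∈ A′
  ∈X∩A⇒∈A′ {x} x∈X x∈A =
    from (A′-pre x) (subst S (sym (redirect-∈ f X r x∈X)) (to (A-pre x) x∈A))

  ∈X∩A′⇒∈A : ∀ {x} → x ∈ X → x ∈ A′ → x ∈ A
  ∈X∩A′⇒∈A {x} x∈X x∈A′ =
    from (A-pre x) (subst S (redirect-∈ f X r x∈X) (to (A′-pre x) x∈A′))

  ∉X⇒∈A′ : S r → ∀ {x} → x ∉ X → x ∈ A′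
  ∉X⇒∈A′ r∈S {x} x∉X = from (A′-pre x) (subst S (sym (redirect-∉ f X r x∉X)) r∈S)

  -- S r need not be decidable; an element outside X, if any, sits at r and decides it.
  redirected-preimage-cases : S r ⊎ A′ ⊆ X
  redirected-preimage-cases with any? (λ x → ¬? (x ∈? X) ×-dec x ∈? A′)
  ... | yes (x , x∉X , x∈A′) = inj₁ (subst S (redirect-∉ f X r x∉X) (to (A′-pre x) x∈A′))
  ... | no ∄ = inj₂ A′⊆X
    where
      A′⊆X : A′ ⊆ X
      A′⊆X {x} x∈A′ with x ∈? X
      ... | yes x∈X = x∈X
      ... | no x∉X  = contradiction (x , x∉X , x∈A′) ∄

  preimage-redirect-⊆ : A′ ⊆ X → A′ ≡ X ∩ A
  preimage-redirect-⊆ A′⊆X = ⊆-antisym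
    (λ x∈A′ → x∈p∩q⁺ (A′⊆X x∈A′ , ∈X∩A′⇒∈A (A′⊆X x∈A′) x∈A′))
    (λ x∈X∩A → let x∈X , x∈A = x∈p∩q⁻ X A x∈X∩A in ∈X∩A⇒∈A′ x∈X x∈A)

  preimage-redirect-∋ : S r → A′ ≡ ∁ (X ∩ ∁ A)
  preimage-redirect-∋ r∈S = ⊆-antisym
    (λ x∈A′ → x∉p⇒x∈∁p λ x∈X∩∁A → let x∈X , x∈∁A = x∈p∩q⁻ X (∁ A) x∈X∩∁A in
      x∈∁p⇒x∉p x∈∁A (∈X∩A′⇒∈A x∈X x∈A′))
    A′⊇∁[X∩∁A]
    where
      A′⊇∁[X∩∁A] : ∁ (X ∩ ∁ A) ⊆ A′
      A′⊇∁[X∩∁A] {x} x∈∁[X∩∁A] with x ∈? X | x ∈? A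
      ... | no x∉X  | _       = ∉X⇒∈A′ r∈S x∉X
      ... | yes x∈X | yes x∈A = ∈X∩A⇒∈A′ x∈X x∈A
      ... | yes x∈X | no x∉A  =
        contradiction (x∈p∩q⁺ (x∈X , x∉p⇒x∈∁p x∉A)) (x∈∁p⇒x∉p x∈∁[X∩∁A])

  fibre-⊆-preimage : ∀ {Y} → (∀ {x} → x ∈ Y → f x ≡ r) → S r → Y ⊆ A
  fibre-⊆-preimage Y⇒r r∈S {x} x∈Y = from (A-pre x) (subst S (sym (Y⇒r x∈Y)) r∈S)

  preimage-avoids-fibre : ∀ {Y} → (∀ {x} → x ∈ Y → f x ≡ r) → X ⊆ ∁ Y →
                          A′ ⊆ X → A ⊆ ∁ Y
  preimage-avoids-fibre Y⇒r X⊆∁Y A′⊆X {x} x∈A = x∉p⇒x∈∁p λ x∈Y →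
    let x∉X = λ x∈X → x∈∁p⇒x∉p (X⊆∁Y x∈X) x∈Y
        r∈S = subst S (Y⇒r x∈Y) (to (A-pre x) x∈A)
    in x∉X (A′⊆X (∉X⇒∈A′ r∈S x∉X))

lemma5p5 : ∀ {n : ℕ} (K : ConnectivitySystem n) (T : Graph) (f : Fin n → Fin (nV T))
    → IsPartialBranchDecomposition n T f
    → (r : Fin (nV T)) → IsLeaf T r
    → (Y : Subset n) → Displays T f r Y
    → (X : Subset n) → X ⊆ ∁ Y
    → IsKappa K X Y (conn K X)
    → ∀ (e : Fin (nE T)) (w w′ : ℕ)
    → IsWidth K T (redirect f X r) e w′
    → IsWidth K T f e w
    → w′ ≤ w
lemma5p5 K T f _ r _ Y displays X X⊆∁Y κ e _ _ (A′ , A′-side , refl) (A , A-side , refl) =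
  side-≤ redirected-preimage-cases
  where
    S = ReachableWithout T e (proj₁ (ends T e))
    open RedirectedPreimage f X r S A-side A′-side
    open ≤-Reasoning
    fibre : ∀ {x} → x ∈ Y → f x ≡ r
    fibre {x} = to (displays x)

    side-≤ : S r ⊎ A′ ⊆ X → conn K A′ ≤ conn K A
    side-≤ (inj₁ r∈S) = begin
      conn K A′             ≡⟨ cong (conn K) (preimage-redirect-∋ r∈S) ⟩
      conn K (∁ (X ∩ ∁ A))  ≡⟨ symmetric K (X ∩ ∁ A) ⟨
      conn K (X ∩ ∁ A)      ≤⟨ kappa-minimal-∩-≤ K κ (p⊆q⇒∁p⊇∁q (fibre-⊆-preimage fibre r∈S)) ⟩
      conn K (∁ A)          ≡⟨ symmetric K A ⟨
      conn K A              ∎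
    side-≤ (inj₂ A′⊆X) = begin
      conn K A′             ≡⟨ cong (conn K) (preimage-redirect-⊆ A′⊆X) ⟩
      conn K (X ∩ A)        ≤⟨ kappa-minimal-∩-≤ K κ (preimage-avoids-fibre fibre X⊆∁Y A′⊆X) ⟩
      conn K A              ∎
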